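{- If $A$ is a connected, non-complete graph with $|V(A)|\ge 4$, then $A\vee E_2$ is $d_1$-choosable.
   Context: All graphs are finite and simple. A list assignment $L$ on $G$ assigns a finite set $L(v)\subseteq\mathbb{N}$ to each vertex; $G$ is $L$-colorable if there is a proper coloring $c$ with $c(v)\in L(v)$ for all $v$. For $f:V(G)\to\mathbb{N}$, $G$ is $f$-choosable if it is $L$-colorable for every $L$ with $|L(v)|=f(v)$ for all $v$. $G$ is $d_1$-choosable if it is $f$-choosable for $f(v)=d_G(v)-1$. $E_2$ is the edgeless graph on $2$ vertices and $A\vee B$ the join. -}

module Defs where

open import Data.Nat using (ℕ; zero; suc; _+_; _∸_)
open import Data.Bool using (Bool; true; false; _∧_; _∨_; not)
open import Data.Fin using (Fin; splitAt; _≟_)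
open import Data.Fin.Properties using ()
open import Data.List using (List; length; filter; allFin)
open import Data.List.Membership.Propositional using (_∈_)
open import Data.List.Relation.Unary.Unique.Propositional using (Unique)
open import Data.Product using (Σ; ∃; _×_; _,_)
open import Data.Sum using (_⊎_; inj₁; inj₂)
open import Relation.Binary.PropositionalEquality using (_≡_)
open import Relation.Nullary using (¬_; does)
open import Data.Empty using (⊥)

record Graph (n : ℕ) : Set where
  field
    adj   : Fin n → Fin n → Bool
    sym   : ∀ u v → adj u v ≡ adj v u
    irref : ∀ v → adj v v ≡ false
open Graph public

Adj : ∀ {n} → Graph n → Fin n → Fin n → Set
Adj G u v = adj G u v ≡ true

degree : ∀ {n} → Graph n → Fin n → ℕ
degree {n} G v = length (filter (λ u → adj G v u ≡? true) (allFin n))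
  where
  open import Data.Bool.Properties using () renaming (_≟_ to _≡?_)

data Walk {n : ℕ} (G : Graph n) : Fin n → Fin n → Set where
  here : ∀ {v} → Walk G v v
  step : ∀ {u w v} → Adj G u w → Walk G w v → Walk G u v

-- Connected: every pair of vertices is joined by a walk
-- (the empty graph on 0 vertices counts as connected; irrelevant here since n ≥ 4).
Connected : ∀ {n} → Graph n → Set
Connected {n} G = ∀ (u v : Fin n) → Walk G u v

Complete : ∀ {n} → Graph n → Set
Complete {n} G = ∀ (u v : Fin n) → ¬ (u ≡ v) → Adj G u v

-- Join A ∨ E₂: vertices Fin (n + 2); the first n are A's vertices,
-- the last two form E₂ (non-adjacent to each other), and every vertex of A
-- is adjacent to both vertices of E₂.
joinAdj : ∀ {n} → Graph n → Fin (n + 2) → Fin (n + 2) → Bool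
joinAdj {n} A x y with splitAt n x | splitAt n y
... | inj₁ a | inj₁ b = adj A a b
... | inj₁ _ | inj₂ _ = true
... | inj₂ _ | inj₁ _ = true
... | inj₂ _ | inj₂ _ = false

joinE2 : ∀ {n} → Graph n → Graph (n + 2)
joinE2 {n} A = record { adj = joinAdj A ; sym = s ; irref = i }
  where
  s : ∀ u v → joinAdj A u v ≡ joinAdj A v u
  s u v with splitAt n u | splitAt n v
  ... | inj₁ a | inj₁ b = sym A a b
  ... | inj₁ _ | inj₂ _ = Relation.Binary.PropositionalEquality.refl
  ... | inj₂ _ | inj₁ _ = Relation.Binary.PropositionalEquality.refl
  ... | inj₂ _ | inj₂ _ = Relation.Binary.PropositionalEquality.refl
  i : ∀ v → joinAdj A v v ≡ false
  i v with splitAt n v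
  ... | inj₁ a = irref A a
  ... | inj₂ _ = Relation.Binary.PropositionalEquality.refl

-- List assignments: each vertex gets a finite set of naturals,
-- represented as a duplicate-free list.
ListAssignment : ℕ → Set
ListAssignment n = Fin n → List ℕ

IsFAssignment : ∀ {n} → (Fin n → ℕ) → ListAssignment n → Set
IsFAssignment {n} f L = ∀ (v : Fin n) → Unique (L v) × length (L v) ≡ f v

LColorable : ∀ {n} → Graph n → ListAssignment n → Set
LColorable {n} G L =
  Σ (Fin n → ℕ) λ c → (∀ v → c v ∈ L v) × (∀ u v → Adj G u v → ¬ (c u ≡ c v))

FChoosable : ∀ {n} → Graph n → (Fin n → ℕ) → Set
FChoosable {n} G f = ∀ (L : ListAssignment n) → IsFAssignment f L → LColorable G L

-- d₁-choosable: f(v) = d_G(v) - 1 (truncated subtraction; irrelevant when degrees ≥ 1).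
D1Choosable : ∀ {n} → Graph n → Set
D1Choosable G = FChoosable G (λ v → degree G v ∸ 1)

-- A non-edge of the connected graph A yields an induced path u – r – w, and since |V(A)| ≥ 4 a
-- fourth vertex t adjacent to that path. With the two vertices x, y of E₂ these six vertices
-- induce a subgraph K of A ∨ E₂, and K alone is d₁-choosable: give the non-adjacent u and w a
-- common colour, or x and y a common colour, or u (or w) a colour that r cannot use. When none
-- of these is possible, Lu and Lw are disjoint sublists of Lr, which their sizes forbid unless t
-- is a third leaf of r; then u, w, t play symmetric roles and the same moves apply to t.
-- Every other vertex is adjacent to both x and y. Colouring those vertices first, each with a
-- colour from its list that is then deleted from the lists of its later neighbours, keeps every
-- remaining list at least as long as the remaining degree minus one, so the colouring extends.

module Submission where

open import Defs hiding (sym)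
open import Data.Nat using (ℕ; suc; _+_; _∸_; _≤_; _<_; _≥_; z≤n; s≤s)
open import Data.Nat.Properties using (≤-trans; <⇒≱; ∸-monoˡ-≤)
import Data.Nat.Properties as ℕ
open import Data.Bool using (Bool; true; false; T; _∨_; if_then_else_)
open import Data.Bool.Properties using (T-∨; T-≡)
import Data.Bool.Properties as Bool
open import Data.Fin using (Fin; _≟_; _↑ˡ_; _↑ʳ_; splitAt) renaming (zero to 0F; suc to sucF)
open import Data.Fin.Properties using (splitAt-↑ˡ; splitAt-↑ʳ; splitAt⁻¹-↑ʳ; ↑ˡ-injective; ↑ʳ-injective)
import Data.Fin.Properties as Fin
open import Data.List using (List; []; _∷_; length; filter; _++_; allFin; map; take)
open import Data.Nat.ListAction using (sum)
open import Data.List.Properties using (length-removeAt′; length-tabulate; length-++; length-take)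
open import Data.List.Membership.Propositional using (_∈_; _∉_; find; lose)
open import Data.List.Membership.Propositional.Properties
  using (∈-filter⁻; ∈-filter⁺; ∈-++⁺ˡ; ∈-++⁺ʳ; ∈-++⁻; ∈-allFin)
import Data.List.Membership.DecPropositional as DecMembership
open import Data.List.Relation.Binary.Subset.Propositional using (_⊆_)
open import Data.List.Relation.Binary.Disjoint.Propositional using (Disjoint)
open import Data.List.Relation.Unary.Any using (here; there; index; _─_; any?)
import Data.List.Relation.Unary.All as All
open All using ([]; _∷_)
open import Data.List.Relation.Unary.AllPairs using ([]; _∷_)
open import Data.List.Relation.Unary.Unique.Propositional using (Unique)
open import Data.List.Relation.Unary.Unique.Propositional.Properties using (filter⁺; allFin⁺; ++⁺; take⁺)
open import Data.Product using (Σ; ∃-syntax; _×_; _,_; proj₁; proj₂)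
open import Data.Sum using (_⊎_; inj₁; inj₂)
open import Data.Empty using (⊥-elim)
open import Function using (id)
open import Function.Bundles using (module Equivalence)
open Equivalence using (from)
open import Relation.Binary.Definitions using (DecidableEquality)
open import Relation.Binary.PropositionalEquality
  using (_≡_; _≢_; ≢-sym; refl; sym; trans; cong; cong₂; subst; subst₂)
open import Relation.Nullary using (¬_; yes; no; ¬?)
open import Relation.Nullary.Decidable using (_×-dec_; decidable-stable)

∈-─ : {A : Set} {a b : A} {xs : List A} (a∈xs : a ∈ xs) → b ∈ xs → b ≢ a → b ∈ (xs ─ a∈xs)
∈-─ (here refl) (here refl) b≢a = ⊥-elim (b≢a refl)
∈-─ (here refl) (there b∈xs) _ = b∈xs
∈-─ (there a∈xs) (here refl) _ = here refl
∈-─ (there a∈xs) (there b∈xs) b≢a = there (∈-─ a∈xs b∈xs b≢a)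

Unique-⊆⇒length≤ : {A : Set} {xs ys : List A} → Unique xs → xs ⊆ ys → length xs ≤ length ys
Unique-⊆⇒length≤ {xs = []} _ _ = z≤n
Unique-⊆⇒length≤ {xs = x ∷ xs} {ys} (x∉xs ∷ uniq) xs⊆ys = begin
    suc (length xs)          ≤⟨ s≤s (Unique-⊆⇒length≤ uniq ⊆ys─x) ⟩
    suc (length (ys ─ x∈ys)) ≡⟨ sym (length-removeAt′ ys (index x∈ys)) ⟩
    length ys                ∎
  where
  open ℕ.≤-Reasoning
  x∈ys = xs⊆ys (here refl)
  ⊆ys─x : xs ⊆ (ys ─ x∈ys)
  ⊆ys─x y∈xs = ∈-─ x∈ys (xs⊆ys (there y∈xs)) (λ y≡x → All.lookup x∉xs y∈xs (sym y≡x))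

Unique-⊆⇒≮ : {A : Set} {xs ys : List A} → Unique xs → xs ⊆ ys → ¬ length ys < length xs
Unique-⊆⇒≮ uniq xs⊆ys |ys|<|xs| = <⇒≱ |ys|<|xs| (Unique-⊆⇒length≤ uniq xs⊆ys)

∉₃ : ∀ {A : Set} {a b c d : A} → a ≢ b → a ≢ c → a ≢ d → a ∉ b ∷ c ∷ d ∷ []
∉₃ a≢b _ _ (here a≡b) = a≢b a≡b
∉₃ _ a≢c _ (there (here a≡c)) = a≢c a≡c
∉₃ _ _ a≢d (there (there (here a≡d))) = a≢d a≡d

∉₃⁻ : ∀ {A : Set} {a b c d : A} → a ∉ b ∷ c ∷ d ∷ [] → a ≢ b × a ≢ c × a ≢ d
∉₃⁻ a∉ = (λ e → a∉ (here e)) , (λ e → a∉ (there (here e))) , (λ e → a∉ (there (there (here e))))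

∉₂⁻ : ∀ {A : Set} {a b c : A} → a ∉ b ∷ c ∷ [] → a ≢ b × a ≢ c
∉₂⁻ a∉ = (λ e → a∉ (here e)) , (λ e → a∉ (there (here e)))

module _ {A : Set} (_≟_ : DecidableEquality A) where
  open DecMembership _≟_ using (_∈?_)

  ∃∉⊎⊆ : (L F : List A) → (∃[ a ] a ∈ L × a ∉ F) ⊎ L ⊆ F
  ∃∉⊎⊆ L F with any? (λ a → ¬? (a ∈? F)) L
  ... | yes some = inj₁ (find some)
  ... | no none = inj₂ λ {a} a∈L → decidable-stable (a ∈? F) (λ a∉F → none (lose a∈L a∉F))

  ∃∈⊎Disjoint : (L M : List A) → (∃[ a ] a ∈ L × a ∈ M) ⊎ Disjoint L M
  ∃∈⊎Disjoint L M with any? (_∈? M) L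
  ... | yes some = inj₁ (find some)
  ... | no none = inj₂ λ (a∈L , a∈M) → none (lose a∈L a∈M)

  longer⇒∃∉ : {L F : List A} → Unique L → length F < length L → ∃[ a ] a ∈ L × a ∉ F
  longer⇒∃∉ {L} {F} uniq |F|<|L| with ∃∉⊎⊆ L F
  ... | inj₁ a∈L∖F = a∈L∖F
  ... | inj₂ L⊆F = ⊥-elim (Unique-⊆⇒≮ uniq L⊆F |F|<|L|)

  complement : (U K : List A) → Unique U → Unique K →
               ∃[ R ] Unique (R ++ K) × U ⊆ R ++ K × (∀ {a} → a ∈ R → a ∉ K)
  complement U K uniqU uniqK = R , ++⁺ (filter⁺ _ uniqU) uniqK (λ (a∈R , a∈K) → R∌K a∈R a∈K) , U⊆R++K , R∌K
    where
    R = filter (λ a → ¬? (a ∈? K)) U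
    R∌K : ∀ {a} → a ∈ R → a ∉ K
    R∌K a∈R = proj₂ (∈-filter⁻ (λ a → ¬? (a ∈? K)) {xs = U} a∈R)
    U⊆R++K : U ⊆ R ++ K
    U⊆R++K {a} a∈U with a ∈? K
    ... | yes a∈K = ∈-++⁺ʳ R a∈K
    ... | no a∉K = ∈-++⁺ˡ (∈-filter⁺ _ a∈U a∉K)

Disjoint-⊆⇒length+≤ : {A : Set} {xs ys zs : List A} → Unique xs → Unique ys → Disjoint xs ys →
                      xs ⊆ zs → ys ⊆ zs → length xs + length ys ≤ length zs
Disjoint-⊆⇒length+≤ {xs = xs} {ys} {zs} uxs uys disjoint xs⊆zs ys⊆zs =
  subst (_≤ length zs) (length-++ xs) (Unique-⊆⇒length≤ (++⁺ uxs uys disjoint) xs++ys⊆zs)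
  where
  xs++ys⊆zs : xs ++ ys ⊆ zs
  xs++ys⊆zs a∈ with ∈-++⁻ xs a∈
  ... | inj₁ a∈xs = xs⊆zs a∈xs
  ... | inj₂ a∈ys = ys⊆zs a∈ys

without : ℕ → List ℕ → List ℕ
without β = filter (λ k → ¬? (k ℕ.≟ β))

∈-without⁻ : ∀ β L {k} → k ∈ without β L → k ∈ L × k ≢ β
∈-without⁻ β L = ∈-filter⁻ (λ k → ¬? (k ℕ.≟ β)) {xs = L}

length-without : ∀ β {L} → Unique L → length L ≤ suc (length (without β L))
length-without β {L} uniq = Unique-⊆⇒length≤ uniq L⊆β∷L∖β
  where
  L⊆β∷L∖β : L ⊆ β ∷ without β L
  L⊆β∷L∖β {k} k∈L with k ℕ.≟ β
  ... | yes k≡β = here k≡β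
  ... | no k≢β = there (∈-filter⁺ _ k∈L k≢β)

⟦_⟧ : Bool → ℕ
⟦ true ⟧ = 1
⟦ false ⟧ = 0

¬Adj-refl : ∀ {m} (G : Graph m) v → ¬ Adj G v v
¬Adj-refl G v vv with trans (sym vv) (irref G v)
... | ()

module _ {m : ℕ} (G : Graph m) where

  degreeIn : List (Fin m) → Fin m → ℕ
  degreeIn S v = length (filter (λ u → adj G v u Bool.≟ true) S)

  ListColouringOn : List (Fin m) → ListAssignment m → Set
  ListColouringOn S L = Σ (Fin m → ℕ) λ c →
    (∀ v → v ∈ S → c v ∈ L v) × (∀ u v → u ∈ S → v ∈ S → Adj G u v → c u ≢ c v)

  D1ChoosableOn : List (Fin m) → Set
  D1ChoosableOn S = ∀ L → (∀ v → v ∈ S → Unique (L v) × degreeIn S v ∸ 1 ≤ length (L v)) →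
                    ListColouringOn S L

  ListColouringOn-∷ : ∀ {v S L} β → v ∉ S → β ∈ L v → (col : ListColouringOn S L) →
                      (∀ {u} → u ∈ S → Adj G u v → proj₁ col u ≢ β) → ListColouringOn (v ∷ S) L
  ListColouringOn-∷ {v} {S} {L} β v∉S β∈Lv (c′ , c′∈L , c′-proper) c′≢β = c , c∈L , proper
    where
    c : Fin m → ℕ
    c z with z ≟ v
    ... | yes _ = β
    ... | no  _ = c′ z

    c-v : c v ≡ β
    c-v with v ≟ v
    ... | yes _ = refl
    ... | no v≢v = ⊥-elim (v≢v refl)

    c-S : ∀ {z} → z ∈ S → c z ≡ c′ z
    c-S {z} z∈S with z ≟ v
    ... | yes refl = ⊥-elim (v∉S z∈S)
    ... | no _ = refl

    c∈L : ∀ z → z ∈ v ∷ S → c z ∈ L z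
    c∈L z (here refl) = subst (_∈ L v) (sym c-v) β∈Lv
    c∈L z (there z∈S) = subst (_∈ L z) (sym (c-S z∈S)) (c′∈L z z∈S)

    proper : ∀ a b → a ∈ v ∷ S → b ∈ v ∷ S → Adj G a b → c a ≢ c b
    proper a b (here refl) (here refl) aa = ⊥-elim (¬Adj-refl G v aa)
    proper a b (here refl) (there b∈S) ab rewrite c-v | c-S b∈S =
      λ β≡c′b → c′≢β b∈S (trans (Graph.sym G b v) ab) (sym β≡c′b)
    proper a b (there a∈S) (here refl) ab rewrite c-v | c-S a∈S = c′≢β a∈S ab
    proper a b (there a∈S) (there b∈S) ab rewrite c-S a∈S | c-S b∈S = c′-proper a b a∈S b∈S ab

  -- Colour v first with some β ∈ L v and delete β from the lists of its neighbours: each of them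
  -- loses at most one colour and exactly one neighbour, so degree − 1 still bounds its list.
  D1ChoosableOn-∷ : ∀ {v S} → v ∉ S → 2 ≤ degreeIn (v ∷ S) v → D1ChoosableOn S → D1ChoosableOn (v ∷ S)
  D1ChoosableOn-∷ {v} {S} v∉S 2≤deg choosableS L sizes =
    ListColouringOn-∷ β v∉S β∈Lv (c′ , c′∈L , proj₂ (proj₂ colouringS)) c′≢β
    where
    sizeV = sizes v (here refl)
    picked = longer⇒∃∉ ℕ._≟_ {F = []} (proj₁ sizeV) (≤-trans (∸-monoˡ-≤ 1 2≤deg) (proj₂ sizeV))
    β = proj₁ picked
    β∈Lv = proj₁ (proj₂ picked)

    L′ : ListAssignment m
    L′ u = if adj G u v then without β (L u) else L u

    sizes′ : ∀ u → u ∈ S → Unique (L′ u) × degreeIn S u ∸ 1 ≤ length (L′ u)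
    sizes′ u u∈S with adj G u v | sizes u (there u∈S)
    ... | true  | uniq , len = filter⁺ _ uniq , ∸-monoˡ-≤ 1 (≤-trans len (length-without β uniq))
    ... | false | uniq , len = uniq , len

    colouringS = choosableS L′ sizes′
    c′ = proj₁ colouringS

    c′∈L : ∀ u → u ∈ S → c′ u ∈ L u
    c′∈L u u∈S with adj G u v | proj₁ (proj₂ colouringS) u u∈S
    ... | true  | c′u∈ = proj₁ (∈-without⁻ β (L u) c′u∈)
    ... | false | c′u∈ = c′u∈

    c′≢β : ∀ {u} → u ∈ S → Adj G u v → c′ u ≢ β
    c′≢β {u} u∈S uv with adj G u v | proj₁ (proj₂ colouringS) u u∈S
    c′≢β {u} u∈S refl | true | c′u∈ = proj₂ (∈-without⁻ β (L u) c′u∈)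

  degreeIn≡sum : ∀ S v → degreeIn S v ≡ sum (map (λ u → ⟦ adj G v u ⟧) S)
  degreeIn≡sum [] v = refl
  degreeIn≡sum (u ∷ S) v with adj G v u
  ... | true = cong suc (degreeIn≡sum S v)
  ... | false = degreeIn≡sum S v

  2≤degreeIn : ∀ {v x y S} → x ≢ y → x ∈ S → y ∈ S → Adj G v x → Adj G v y → 2 ≤ degreeIn S v
  2≤degreeIn {v} {x} {y} {S} x≢y x∈S y∈S vx vy = Unique-⊆⇒length≤ ((x≢y ∷ []) ∷ [] ∷ []) xy⊆
    where
    xy⊆ : x ∷ y ∷ [] ⊆ filter (λ u → adj G v u Bool.≟ true) S
    xy⊆ (here refl) = ∈-filter⁺ _ x∈S vx
    xy⊆ (there (here refl)) = ∈-filter⁺ _ y∈S vy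

  D1ChoosableOn-++ : ∀ {x y K} → x ≢ y → x ∈ K → y ∈ K → (R : List (Fin m)) → Unique (R ++ K) →
                     (∀ {v} → v ∈ R → Adj G v x × Adj G v y) → D1ChoosableOn K → D1ChoosableOn (R ++ K)
  D1ChoosableOn-++ x≢y x∈K y∈K [] _ _ choosableK = choosableK
  D1ChoosableOn-++ {K = K} x≢y x∈K y∈K (v ∷ R) (v∉R++K ∷ uniq) adjR choosableK =
    D1ChoosableOn-∷ (λ v∈ → All.lookup v∉R++K v∈ refl)
      (2≤degreeIn x≢y (there (∈-++⁺ʳ R x∈K)) (there (∈-++⁺ʳ R y∈K))
        (proj₁ (adjR (here refl))) (proj₂ (adjR (here refl))))
      (D1ChoosableOn-++ x≢y x∈K y∈K R uniq (λ v∈R → adjR (there v∈R)) choosableK)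

  D1ChoosableOn⇒D1Choosable : ∀ {S} → Unique S → (∀ v → v ∈ S) → D1ChoosableOn S → D1Choosable G
  D1ChoosableOn⇒D1Choosable {S} uniq complete choosableS L fAssignment with choosableS L sizes
    where
    degreeIn≤degree : ∀ v → degreeIn S v ≤ degree G v
    degreeIn≤degree v = Unique-⊆⇒length≤ (filter⁺ _ uniq)
      (λ {u} u∈ → ∈-filter⁺ _ (∈-allFin u) (proj₂ (∈-filter⁻ (λ u → adj G v u Bool.≟ true) {xs = S} u∈)))
    sizes : ∀ v → v ∈ S → Unique (L v) × degreeIn S v ∸ 1 ≤ length (L v)
    sizes v _ = proj₁ (fAssignment v) ,
      subst (degreeIn S v ∸ 1 ≤_) (sym (proj₂ (fAssignment v))) (∸-monoˡ-≤ 1 (degreeIn≤degree v))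
  ... | c , c∈L , proper = c , (λ v → c∈L v (complete v)) , (λ u v → proper u v (complete u) (complete v))

module _ {n : ℕ} (A : Graph n) where
  open DecMembership (_≟_ {n}) using () renaming (_∈?_ to _∈ᵥ?_)

  ¬Complete⇒nonAdjacentPair : ¬ Complete A → ∃[ u ] ∃[ w ] u ≢ w × adj A u w ≡ false
  ¬Complete⇒nonAdjacentPair ¬complete
    with Fin.any? (λ u → Fin.any? (λ w → ¬? (u ≟ w) ×-dec (adj A u w Bool.≟ false)))
  ... | yes pair = pair
  ... | no none = ⊥-elim (¬complete complete)
    where
    complete : Complete A
    complete u w u≢w with adj A u w in uw
    ... | true = refl
    ... | false = ⊥-elim (none (u , w , u≢w , uw))

  -- Invariant: the walk starts at u or at a neighbour of u.
  walk⇒inducedPath : ∀ u {a b} → Walk A a b → (a ≡ u ⊎ Adj A u a) → b ≢ u → adj A u b ≡ false →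
                     ∃[ r ] ∃[ w ] Adj A u r × Adj A r w × adj A u w ≡ false × w ≢ u
  walk⇒inducedPath u here (inj₁ b≡u) b≢u _ = ⊥-elim (b≢u b≡u)
  walk⇒inducedPath u here (inj₂ ub) _ u≁b with () ← trans (sym ub) u≁b
  walk⇒inducedPath u (step {a} {m} am walk) a≈u b≢u u≁b with m ≟ u | adj A u m in um
  ... | yes m≡u | _ = walk⇒inducedPath u walk (inj₁ m≡u) b≢u u≁b
  ... | no _ | true = walk⇒inducedPath u walk (inj₂ um) b≢u u≁b
  ... | no m≢u | false with a≈u
  ...   | inj₁ refl with () ← trans (sym am) um
  ...   | inj₂ ua = a , m , ua , am , um , m≢u

  walk⇒crossingEdge : ∀ F {a b} → Walk A a b → a ∉ F → b ∈ F → ∃[ t ] ∃[ s ] t ∉ F × s ∈ F × Adj A t s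
  walk⇒crossingEdge F here a∉F a∈F = ⊥-elim (a∉F a∈F)
  walk⇒crossingEdge F (step {a} {m} am walk) a∉F b∈F with m ∈ᵥ? F
  ... | yes m∈F = a , m , a∉F , m∈F , am
  ... | no m∉F = walk⇒crossingEdge F walk m∉F b∈F

  T-adjacentToOneOf : ∀ {t s u r w} → s ∈ u ∷ r ∷ w ∷ [] → Adj A t s → T (adj A t u ∨ adj A t r ∨ adj A t w)
  T-adjacentToOneOf (here refl) ts = from T-∨ (inj₁ (from T-≡ ts))
  T-adjacentToOneOf {t} {u = u} (there (here refl)) ts = from (T-∨ {adj A t u}) (inj₂ (from T-∨ (inj₁ (from T-≡ ts))))
  T-adjacentToOneOf {t} {u = u} {r} (there (there (here refl))) ts =
    from (T-∨ {adj A t u}) (inj₂ (from (T-∨ {adj A t r}) (inj₂ (from T-≡ ts))))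

  record Skeleton : Set where
    field
      u r w t : Fin n
      u~r : Adj A u r
      r~w : Adj A r w
      u≁w : adj A u w ≡ false
      w≢u : w ≢ u
      t∉urw : t ∉ u ∷ r ∷ w ∷ []
      t~urw : T (adj A t u ∨ adj A t r ∨ adj A t w)

  skeleton : 4 ≤ n → Connected A → ¬ Complete A → Skeleton
  skeleton 4≤n connected ¬complete with ¬Complete⇒nonAdjacentPair ¬complete
  ... | u , w₀ , u≢w₀ , u≁w₀ with walk⇒inducedPath u (connected u w₀) (inj₁ refl) (≢-sym u≢w₀) u≁w₀
  ... | r , w , u~r , r~w , u≁w , w≢u
    with longer⇒∃∉ _≟_ {F = u ∷ r ∷ w ∷ []} (allFin⁺ n) (subst (3 <_) (sym (length-tabulate id)) 4≤n)
  ... | z , _ , z∉urw with walk⇒crossingEdge (u ∷ r ∷ w ∷ []) (connected z u) z∉urw (here refl)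
  ... | t , s , t∉urw , s∈urw , ts =
    record { u = u ; r = r ; w = w ; t = t ; u~r = u~r ; r~w = r~w ; u≁w = u≁w ; w≢u = w≢u
           ; t∉urw = t∉urw ; t~urw = T-adjacentToOneOf s∈urw ts }

open DecMembership ℕ._≟_ using (_∈?_)

[_]if_ : ℕ → Bool → List ℕ
[ k ]if true = k ∷ []
[ k ]if false = []

T⇒⟦⟧≡1 : ∀ {b} → T b → ⟦ b ⟧ ≡ 1
T⇒⟦⟧≡1 {true} _ = refl

length-[]if : ∀ k b → length ([ k ]if b) ≡ ⟦ b ⟧
length-[]if k true = refl
length-[]if k false = refl

∈-[]if⁺ : ∀ {a k b} → T b → a ≡ k → a ∈ [ k ]if b
∈-[]if⁺ {b = true} _ a≡k = here a≡k

∉-[]if⇒≢ : ∀ {a k b} → a ∉ [ k ]if b → T b → a ≢ k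
∉-[]if⇒≢ a∉ t a≡k = a∉ (∈-[]if⁺ t a≡k)

-- The lists of the six vertices x, y (the copy of E₂), u, r, w (an induced path u–r–w of A)
-- and t (adjacent to u, r, w according to tu, tr, tw); each has size degree − 1 in that
-- induced subgraph of A ∨ E₂.
record SkeletonLists (tu tr tw : Bool) (X Y Lu Lr Lw Lt : List ℕ) : Set where
  field
    uniqX : Unique X
    uniqY : Unique Y
    uniqU : Unique Lu
    uniqR : Unique Lr
    uniqW : Unique Lw
    uniqT : Unique Lt
    lenX : length X ≡ 3
    lenY : length Y ≡ 3
    lenU : length Lu ≡ 2 + ⟦ tu ⟧
    lenR : length Lr ≡ 3 + ⟦ tr ⟧
    lenW : length Lw ≡ 2 + ⟦ tw ⟧
    lenT : length Lt ≡ suc (⟦ tu ⟧ + ⟦ tr ⟧ + ⟦ tw ⟧)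

record SkeletonColouring (tu tr tw : Bool) (X Y Lu Lr Lw Lt : List ℕ) : Set where
  constructor colouring
  field
    cx cy cu cr cw ct : ℕ
    cx∈X : cx ∈ X
    cy∈Y : cy ∈ Y
    cu∈Lu : cu ∈ Lu
    cr∈Lr : cr ∈ Lr
    cw∈Lw : cw ∈ Lw
    ct∈Lt : ct ∈ Lt
    cx∉uwt : cx ∉ cu ∷ cw ∷ ct ∷ []
    cy∉uwt : cy ∉ cu ∷ cw ∷ ct ∷ []
    cx≢cr : cx ≢ cr
    cy≢cr : cy ≢ cr
    cr≢cu : cr ≢ cu
    cr≢cw : cr ≢ cw
    cr≢ct : T tr → cr ≢ ct
    ct≢cu : T tu → ct ≢ cu
    ct≢cw : T tw → ct ≢ cw

module _ {tu tr tw : Bool} {X Y Lu Lr Lw Lt : List ℕ} where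

  SkeletonLists-swapXY : SkeletonLists tu tr tw X Y Lu Lr Lw Lt → SkeletonLists tu tr tw Y X Lu Lr Lw Lt
  SkeletonLists-swapXY H = record
    { uniqX = uniqY ; uniqY = uniqX ; uniqU = uniqU ; uniqR = uniqR ; uniqW = uniqW ; uniqT = uniqT
    ; lenX = lenY ; lenY = lenX ; lenU = lenU ; lenR = lenR ; lenW = lenW ; lenT = lenT }
    where open SkeletonLists H

  SkeletonLists-swapUW : SkeletonLists tu tr tw X Y Lu Lr Lw Lt → SkeletonLists tw tr tu X Y Lw Lr Lu Lt
  SkeletonLists-swapUW H = record
    { uniqX = uniqX ; uniqY = uniqY ; uniqU = uniqW ; uniqR = uniqR ; uniqW = uniqU ; uniqT = uniqT
    ; lenX = lenX ; lenY = lenY ; lenU = lenW ; lenR = lenR ; lenW = lenU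
    ; lenT = trans lenT (cong suc (a+b+c≡c+b+a ⟦ tu ⟧ ⟦ tr ⟧ ⟦ tw ⟧)) }
    where
    open SkeletonLists H
    a+b+c≡c+b+a : ∀ a b c → a + b + c ≡ c + b + a
    a+b+c≡c+b+a a b c = trans (ℕ.+-comm (a + b) c) (trans (cong (c +_) (ℕ.+-comm a b)) (sym (ℕ.+-assoc c b a)))

  SkeletonColouring-swapXY : SkeletonColouring tu tr tw Y X Lu Lr Lw Lt → SkeletonColouring tu tr tw X Y Lu Lr Lw Lt
  SkeletonColouring-swapXY (colouring cx cy cu cr cw ct x y u r w t x∉ y∉ xr yr ru rw rt tu′ tw′) =
    colouring cy cx cu cr cw ct y x u r w t y∉ x∉ yr xr ru rw rt tu′ tw′

  SkeletonColouring-swapUW : SkeletonColouring tw tr tu X Y Lw Lr Lu Lt → SkeletonColouring tu tr tw X Y Lu Lr Lw Lt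
  SkeletonColouring-swapUW (colouring cx cy cu cr cw ct x y u r w t x∉ y∉ xr yr ru rw rt tu′ tw′) =
    colouring cx cy cw cr cu ct x y w r u t (swap₁₂ x∉) (swap₁₂ y∉) xr yr rw ru rt tw′ tu′
    where
    swap₁₂ : ∀ {a b c d} → a ∉ b ∷ c ∷ d ∷ [] → a ∉ c ∷ b ∷ d ∷ []
    swap₁₂ a∉ = let a≢b , a≢c , a≢d = ∉₃⁻ a∉ in ∉₃ a≢c a≢b a≢d

module _ {X Y Lu Lr Lw Lt : List ℕ} where

  SkeletonLists-swapUT : SkeletonLists false true false X Y Lu Lr Lw Lt → SkeletonLists false true false X Y Lt Lr Lw Lu
  SkeletonLists-swapUT H = record
    { uniqX = uniqX ; uniqY = uniqY ; uniqU = uniqT ; uniqR = uniqR ; uniqW = uniqW ; uniqT = uniqU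
    ; lenX = lenX ; lenY = lenY ; lenU = lenT ; lenR = lenR ; lenW = lenW ; lenT = lenU }
    where open SkeletonLists H

  SkeletonLists-swapWT : SkeletonLists false true false X Y Lu Lr Lw Lt → SkeletonLists false true false X Y Lu Lr Lt Lw
  SkeletonLists-swapWT H = record
    { uniqX = uniqX ; uniqY = uniqY ; uniqU = uniqU ; uniqR = uniqR ; uniqW = uniqT ; uniqT = uniqW
    ; lenX = lenX ; lenY = lenY ; lenU = lenU ; lenR = lenR ; lenW = lenT ; lenT = lenW }
    where open SkeletonLists H

  SkeletonColouring-swapUT : SkeletonColouring false true false X Y Lt Lr Lw Lu →
                             SkeletonColouring false true false X Y Lu Lr Lw Lt
  SkeletonColouring-swapUT (colouring cx cy cu cr cw ct x y u r w t x∉ y∉ xr yr ru rw rt _ _) =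
    colouring cx cy ct cr cw cu x y t r w u (swap₁₃ x∉) (swap₁₃ y∉) xr yr (rt _) rw (λ _ → ru) (λ ()) (λ ())
    where
    swap₁₃ : ∀ {a b c d} → a ∉ b ∷ c ∷ d ∷ [] → a ∉ d ∷ c ∷ b ∷ []
    swap₁₃ a∉ = let a≢b , a≢c , a≢d = ∉₃⁻ a∉ in ∉₃ a≢d a≢c a≢b

  SkeletonColouring-swapWT : SkeletonColouring false true false X Y Lu Lr Lt Lw →
                             SkeletonColouring false true false X Y Lu Lr Lw Lt
  SkeletonColouring-swapWT (colouring cx cy cu cr cw ct x y u r w t x∉ y∉ xr yr ru rw rt _ _) =
    colouring cx cy cu cr ct cw x y u r t w (swap₂₃ x∉) (swap₂₃ y∉) xr yr ru (rt _) (λ _ → rw) (λ ()) (λ ())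
    where
    swap₂₃ : ∀ {a b c d} → a ∉ b ∷ c ∷ d ∷ [] → a ∉ b ∷ d ∷ c ∷ []
    swap₂₃ a∉ = let a≢b , a≢c , a≢d = ∉₃⁻ a∉ in ∉₃ a≢b a≢d a≢c

Covers : List ℕ → List ℕ → List ℕ → Set
Covers L F C = ∀ {j} → j ∈ L → j ∈ F → j ∈ C

Covers-refl : ∀ {L F} → Covers L F F
Covers-refl _ j∈F = j∈F

Covers-dup : ∀ {L F C a} → Covers L (a ∷ F) C → Covers L (a ∷ a ∷ F) C
Covers-dup cov j∈L (here j≡a) = cov j∈L (here j≡a)
Covers-dup cov j∈L (there j∈) = cov j∈L j∈

Covers-∉ : ∀ {L F C a} → a ∉ L → Covers L F C → Covers L (a ∷ F) C
Covers-∉ a∉L cov j∈L (here refl) = ⊥-elim (a∉L j∈L)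
Covers-∉ a∉L cov j∈L (there j∈) = cov j∈L j∈

coveredByOne⊎both : ∀ L a b → (∃[ ξ ] Covers L (a ∷ b ∷ []) (ξ ∷ [])) ⊎ (a ∈ L × b ∈ L × a ≢ b)
coveredByOne⊎both L a b with a ∈? L | b ∈? L | a ℕ.≟ b
... | no a∉L | _ | _ = inj₁ (b , λ { j∈L (here refl) → ⊥-elim (a∉L j∈L) ; _ (there j∈) → j∈ })
... | yes _ | no b∉L | _ = inj₁ (a , λ { _ (here j≡a) → here j≡a ; j∈L (there (here refl)) → ⊥-elim (b∉L j∈L) })
... | yes _ | yes _ | yes a≡b =
  inj₁ (a , λ { _ (here j≡a) → here j≡a ; _ (there (here j≡b)) → here (trans j≡b (sym a≡b)) })
... | yes a∈L | yes b∈L | no a≢b = inj₂ (a∈L , b∈L , a≢b)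

pickAvoiding : ∀ {L F C} q → Unique L → Covers L F C → suc (length C) < length L → ∃[ a ] a ∈ L × a ≢ q × a ∉ F
pickAvoiding {C = C} q uniq cov len with longer⇒∃∉ ℕ._≟_ {F = q ∷ C} uniq len
... | a , a∈L , a∉q∷C = a , a∈L , (λ a≡q → a∉q∷C (here a≡q)) , (λ a∈F → a∉q∷C (there (cov a∈L a∈F)))

pickFrom : ∀ {L : List ℕ} F {k} → Unique L → length L ≡ k → length F < k → ∃[ a ] a ∈ L × a ∉ F
pickFrom F uniq |L|≡k len = longer⇒∃∉ ℕ._≟_ {F = F} uniq (subst (length F <_) (sym |L|≡k) len)

record UWTColouring (tu tw : Bool) (Lu Lw Lt : List ℕ) : Set where
  constructor uwt
  field
    cu cw ct : ℕ
    cu∈Lu : cu ∈ Lu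
    cw∈Lw : cw ∈ Lw
    ct∈Lt : ct ∈ Lt
    ct≢cu : T tu → ct ≢ cu
    ct≢cw : T tw → ct ≢ cw

  UWT : List ℕ
  UWT = cu ∷ cw ∷ ct ∷ []

  ForbiddenR : Bool → List ℕ
  ForbiddenR tr = cu ∷ cw ∷ [ ct ]if tr

module Completion {tu tr tw : Bool} {X Y Lu Lr Lw Lt : List ℕ} (H : SkeletonLists tu tr tw X Y Lu Lr Lw Lt)
                  (P : UWTColouring tu tw Lu Lw Lt) where
  open SkeletonLists H
  open UWTColouring P

  private
    pickR : ∀ q ρ → Covers Lr (ForbiddenR tr) (ρ ∷ [ ct ]if tr) →
            ∃[ cr ] cr ∈ Lr × cr ≢ q × cr ≢ cu × cr ≢ cw × (T tr → cr ≢ ct)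
    pickR q ρ cov with pickAvoiding q uniqR cov (subst (3 + length ([ ct ]if tr) ≤_) (sym lenR) len)
      where
      len : 3 + length ([ ct ]if tr) ≤ 3 + ⟦ tr ⟧
      len rewrite length-[]if ct tr = ℕ.≤-refl
    ... | cr , cr∈ , cr≢q , cr∉ =
      cr , cr∈ , cr≢q , (λ e → cr∉ (here e)) , (λ e → cr∉ (there (here e))) ,
      (λ t e → cr∉ (there (there (∈-[]if⁺ t e))))

  completeWithCommon : ∀ k → k ∈ X → k ∈ Y → k ∉ UWT → ∀ ρ → Covers Lr (ForbiddenR tr) (ρ ∷ [ ct ]if tr) →
                       SkeletonColouring tu tr tw X Y Lu Lr Lw Lt
  completeWithCommon k k∈X k∈Y k∉ ρ cov with pickR k ρ cov
  ... | cr , cr∈ , cr≢k , cr≢cu , cr≢cw , cr≢ct =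
    colouring k k cu cr cw ct k∈X k∈Y cu∈Lu cr∈ cw∈Lw ct∈Lt k∉ k∉ (≢-sym cr≢k) (≢-sym cr≢k)
      cr≢cu cr≢cw cr≢ct ct≢cu ct≢cw

  completeGivenY : ∀ cy → cy ∈ Y → cy ∉ UWT → ∀ ξ → Covers X UWT (ξ ∷ []) →
                   ∀ ρ → Covers Lr (ForbiddenR tr) (ρ ∷ [ ct ]if tr) → SkeletonColouring tu tr tw X Y Lu Lr Lw Lt
  completeGivenY cy cy∈Y cy∉ ξ covX ρ covR with pickR cy ρ covR
  ... | cr , cr∈ , cr≢cy , cr≢cu , cr≢cw , cr≢ct with pickAvoiding cr uniqX covX (subst (3 ≤_) (sym lenX) ℕ.≤-refl)
  ... | cx , cx∈ , cx≢cr , cx∉ =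
    colouring cx cy cu cr cw ct cx∈ cy∈Y cu∈Lu cr∈ cw∈Lw ct∈Lt cx∉ cy∉ cx≢cr (≢-sym cr≢cy)
      cr≢cu cr≢cw cr≢ct ct≢cu ct≢cw

completeGivenX : ∀ {tu tr tw X Y Lu Lr Lw Lt} (H : SkeletonLists tu tr tw X Y Lu Lr Lw Lt)
                 (P : UWTColouring tu tw Lu Lw Lt) → let open UWTColouring P in
                 ∀ cx → cx ∈ X → cx ∉ UWT → ∀ ξ → Covers Y UWT (ξ ∷ []) →
                 ∀ ρ → Covers Lr (ForbiddenR tr) (ρ ∷ [ ct ]if tr) → SkeletonColouring tu tr tw X Y Lu Lr Lw Lt
completeGivenX H P cx cx∈X cx∉ ξ covY ρ covR =
  SkeletonColouring-swapXY (Completion.completeGivenY (SkeletonLists-swapXY H) P cx cx∈X cx∉ ξ covY ρ covR)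

∉-dup : ∀ {a b : ℕ} {F} → a ∉ b ∷ F → a ∉ b ∷ b ∷ F
∉-dup a∉ (here a≡b) = a∉ (here a≡b)
∉-dup a∉ (there a∈) = a∉ a∈

-- What sameColourUW leaves open: every colour of t other than ct is α.
TightCase : (tu tr tw : Bool) (X Y Lu Lr Lw Lt : List ℕ) → Set
TightCase tu tr tw X Y Lu Lr Lw Lt = ∀ {α} → α ∈ Lu → α ∈ Lw →
  ∀ ct → ct ∈ Lt → ct ≢ α → Lt ⊆ ct ∷ [ α ]if (tu ∨ tw) → ct ∈ X → ct ∈ Y →
  SkeletonColouring tu tr tw X Y Lu Lr Lw Lt

NestedCase : (tu tr tw : Bool) (X Y Lu Lr Lw Lt : List ℕ) → Set
NestedCase tu tr tw X Y Lu Lr Lw Lt =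
  Disjoint X Y → Disjoint Lu Lw → Lu ⊆ Lr → Lw ⊆ Lr → SkeletonColouring tu tr tw X Y Lu Lr Lw Lt

module _ {tu tr tw : Bool} {X Y Lu Lr Lw Lt : List ℕ} (H : SkeletonLists tu tr tw X Y Lu Lr Lw Lt)
         {α : ℕ} (α∈Lu : α ∈ Lu) (α∈Lw : α ∈ Lw) where
  open SkeletonLists H

  private
    uwtWith : ∀ ct → ct ∈ Lt → ct ∉ [ α ]if (tu ∨ tw) → UWTColouring tu tw Lu Lw Lt
    uwtWith ct ct∈Lt ct∉ = uwt α α ct α∈Lu α∈Lw ct∈Lt
      (λ t → ∉-[]if⇒≢ ct∉ (from T-∨ (inj₁ t))) (λ t → ∉-[]if⇒≢ ct∉ (from (T-∨ {tu}) (inj₂ t)))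

    viaX : ∀ ct ct∈Lt ct∉ ξ → Covers X (α ∷ ct ∷ []) (ξ ∷ []) → SkeletonColouring tu tr tw X Y Lu Lr Lw Lt
    viaX ct ct∈Lt ct∉ ξ covX with pickFrom (α ∷ ct ∷ []) uniqY lenY ℕ.≤-refl
    ... | cy , cy∈Y , cy∉ = Completion.completeGivenY H (uwtWith ct ct∈Lt ct∉) cy cy∈Y (∉-dup cy∉) ξ (Covers-dup covX)
                              α (Covers-dup Covers-refl)

    viaY : ∀ ct ct∈Lt ct∉ ξ → Covers Y (α ∷ ct ∷ []) (ξ ∷ []) → SkeletonColouring tu tr tw X Y Lu Lr Lw Lt
    viaY ct ct∈Lt ct∉ ξ covY with pickFrom (α ∷ ct ∷ []) uniqX lenX ℕ.≤-refl
    ... | cx , cx∈X , cx∉ = completeGivenX H (uwtWith ct ct∈Lt ct∉) cx cx∈X (∉-dup cx∉) ξ (Covers-dup covY)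
                              α (Covers-dup Covers-refl)

    tryT : ∀ ct → ct ∈ Lt → ct ∉ [ α ]if (tu ∨ tw) →
           SkeletonColouring tu tr tw X Y Lu Lr Lw Lt ⊎ (ct ∈ X × ct ∈ Y × ct ≢ α)
    tryT ct ct∈Lt ct∉ with coveredByOne⊎both X α ct | coveredByOne⊎both Y α ct
    ... | inj₁ (ξ , covX) | _ = inj₁ (viaX ct ct∈Lt ct∉ ξ covX)
    ... | inj₂ _ | inj₁ (ξ , covY) = inj₁ (viaY ct ct∈Lt ct∉ ξ covY)
    ... | inj₂ (_ , ct∈X , α≢ct) | inj₂ (_ , ct∈Y , _) = inj₂ (ct∈X , ct∈Y , ≢-sym α≢ct)

    ⟦∨⟧<1+⟦⟧+⟦⟧+⟦⟧ : ∀ a b c → ⟦ a ∨ c ⟧ < suc (⟦ a ⟧ + ⟦ b ⟧ + ⟦ c ⟧)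
    ⟦∨⟧<1+⟦⟧+⟦⟧+⟦⟧ true _ _ = s≤s (s≤s z≤n)
    ⟦∨⟧<1+⟦⟧+⟦⟧+⟦⟧ false true true = s≤s (s≤s z≤n)
    ⟦∨⟧<1+⟦⟧+⟦⟧+⟦⟧ false false true = s≤s (s≤s z≤n)
    ⟦∨⟧<1+⟦⟧+⟦⟧+⟦⟧ false _ false = s≤s z≤n

  -- With u and w both coloured α, a colour ct of t fails only if α ≠ ct both lie in X and in Y;
  -- if a second colour ct′ of t fails as well, then ct′ is a common colour for x and y.
  sameColourUW : TightCase tu tr tw X Y Lu Lr Lw Lt → SkeletonColouring tu tr tw X Y Lu Lr Lw Lt
  sameColourUW tight
    with pickFrom ([ α ]if (tu ∨ tw)) uniqT lenT
           (subst (_< _) (sym (length-[]if α (tu ∨ tw))) (⟦∨⟧<1+⟦⟧+⟦⟧+⟦⟧ tu tr tw))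
  ... | ct , ct∈Lt , ct∉ with tryT ct ct∈Lt ct∉
  ... | inj₁ done = done
  ... | inj₂ (ct∈X , ct∈Y , ct≢α) with ∃∉⊎⊆ ℕ._≟_ Lt (ct ∷ [ α ]if (tu ∨ tw))
  ...   | inj₂ Lt⊆ = tight α∈Lu α∈Lw ct ct∈Lt ct≢α Lt⊆ ct∈X ct∈Y
  ...   | inj₁ (ct′ , ct′∈Lt , ct′∉) with tryT ct′ ct′∈Lt (λ ct′∈ → ct′∉ (there ct′∈))
  ...     | inj₁ done = done
  ...     | inj₂ (ct′∈X , ct′∈Y , ct′≢α) =
    Completion.completeWithCommon H (uwtWith ct ct∈Lt ct∉) ct′ ct′∈X ct′∈Y
      (∉₃ ct′≢α ct′≢α (λ ct′≡ct → ct′∉ (here ct′≡ct))) α (Covers-dup Covers-refl)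

length-[]if≤ : ∀ k b → length ([ k ]if b) ≤ ⟦ b ⟧
length-[]if≤ k b = ℕ.≤-reflexive (length-[]if k b)

∈-∉⇒≢ : ∀ {a b : ℕ} {L} → a ∈ L → b ∉ L → a ≢ b
∈-∉⇒≢ a∈L b∉L refl = b∉L a∈L

module _ {tu tr tw : Bool} {X Y Lu Lr Lw Lt : List ℕ} (H : SkeletonLists tu tr tw X Y Lu Lr Lw Lt) where
  open SkeletonLists H

  -- x and y share β; t, w, r, u are then coloured greedily in this order, and β ∉ Lu keeps u off β.
  sameColourXY : 1 < length Lt → ∀ {β} → β ∈ X → β ∈ Y → β ∉ Lu → SkeletonColouring tu tr tw X Y Lu Lr Lw Lt
  sameColourXY 1<|Lt| {β} β∈X β∈Y β∉Lu with longer⇒∃∉ ℕ._≟_ {F = β ∷ []} uniqT 1<|Lt|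
  ... | ct , ct∈Lt , ct∉ with pickFrom (β ∷ [ ct ]if tw) uniqW lenW (s≤s (s≤s (length-[]if≤ ct tw)))
  ... | cw , cw∈Lw , cw∉ with pickFrom (β ∷ cw ∷ [ ct ]if tr) uniqR lenR (s≤s (s≤s (s≤s (length-[]if≤ ct tr))))
  ... | cr , cr∈Lr , cr∉ with pickFrom (cr ∷ [ ct ]if tu) uniqU lenU (s≤s (s≤s (length-[]if≤ ct tu)))
  ... | cu , cu∈Lu , cu∉ =
    colouring β β cu cr cw ct β∈X β∈Y cu∈Lu cr∈Lr cw∈Lw ct∈Lt β∉uwt β∉uwt β≢cr β≢cr
      (λ cr≡cu → cu∉ (here (sym cr≡cu))) (λ cr≡cw → cr∉ (there (here cr≡cw)))
      (λ t → ∉-[]if⇒≢ (λ m → cr∉ (there (there m))) t)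
      (λ t ct≡cu → ∉-[]if⇒≢ (λ m → cu∉ (there m)) t (sym ct≡cu))
      (λ t ct≡cw → ∉-[]if⇒≢ (λ m → cw∉ (there m)) t (sym ct≡cw))
    where
    β≢cr : β ≢ cr
    β≢cr β≡cr = cr∉ (here (sym β≡cr))
    β∉uwt : β ∉ cu ∷ cw ∷ ct ∷ []
    β∉uwt = ∉₃ (≢-sym (∈-∉⇒≢ cu∈Lu β∉Lu)) (λ β≡cw → cw∉ (here (sym β≡cw)))
               (λ β≡ct → ct∉ (here (sym β≡ct)))

  -- Here t is a leaf at u, so it may repeat the colour of r or of w.
  tightCase-P4 : tu ≡ true → tr ≡ false → tw ≡ false → TightCase tu tr tw X Y Lu Lr Lw Lt
  tightCase-P4 refl refl refl {α} α∈Lu α∈Lw τ τ∈Lt τ≢α Lt⊆τα τ∈X τ∈Y with τ ∈? Lr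
  ... | yes τ∈Lr with pickFrom (α ∷ τ ∷ []) uniqX lenX ℕ.≤-refl | pickFrom (α ∷ τ ∷ []) uniqY lenY ℕ.≤-refl
  ...   | cx , cx∈X , cx∉ | cy , cy∈Y , cy∉ =
    colouring cx cy α τ α τ cx∈X cy∈Y α∈Lu τ∈Lr α∈Lw τ∈Lt (∉-dup cx∉) (∉-dup cy∉)
      (proj₂ (∉₂⁻ cx∉)) (proj₂ (∉₂⁻ cy∉)) τ≢α τ≢α (λ ()) (λ _ → τ≢α) (λ ())
  tightCase-P4 refl refl refl {α} α∈Lu α∈Lw τ τ∈Lt τ≢α Lt⊆τα τ∈X τ∈Y | no τ∉Lr with α ∈? Lt
  ... | no α∉Lt = ⊥-elim (Unique-⊆⇒≮ uniqT Lt⊆τ (subst (1 <_) (sym lenT) ℕ.≤-refl))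
    where
    Lt⊆τ : Lt ⊆ τ ∷ []
    Lt⊆τ a∈Lt with Lt⊆τα a∈Lt
    ... | here a≡τ = here a≡τ
    ... | there (here refl) = ⊥-elim (α∉Lt a∈Lt)
  ... | yes α∈Lt with pickFrom (α ∷ τ ∷ []) uniqU lenU ℕ.≤-refl
  ...   | cu , cu∈Lu , cu∉ with pickFrom (α ∷ cu ∷ []) uniqR lenR ℕ.≤-refl
  ...   | cr , cr∈Lr , cr∉ =
    colouring τ τ cu cr α α τ∈X τ∈Y cu∈Lu cr∈Lr α∈Lw α∈Lt τ∉uwt τ∉uwt τ≢cr τ≢cr
      (proj₂ (∉₂⁻ cr∉)) (proj₁ (∉₂⁻ cr∉)) (λ ()) (λ _ α≡cu → proj₁ (∉₂⁻ cu∉) (sym α≡cu)) (λ ())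
    where
    τ≢cr : τ ≢ cr
    τ≢cr = ≢-sym (∈-∉⇒≢ cr∈Lr τ∉Lr)
    τ∉uwt : τ ∉ cu ∷ α ∷ α ∷ []
    τ∉uwt = ∉₃ (λ τ≡cu → proj₂ (∉₂⁻ cu∉) (sym τ≡cu)) τ≢α τ≢α

  tightCase-impossible : suc ⟦ tu ∨ tw ⟧ < suc (⟦ tu ⟧ + ⟦ tr ⟧ + ⟦ tw ⟧) → TightCase tu tr tw X Y Lu Lr Lw Lt
  tightCase-impossible len {α} _ _ ct _ _ Lt⊆ _ _ =
    ⊥-elim (Unique-⊆⇒≮ uniqT Lt⊆ (subst₂ (λ k l → suc k < l) (sym (length-[]if α (tu ∨ tw))) (sym lenT) len))

  nestedCase-impossible : 3 + ⟦ tr ⟧ < 2 + ⟦ tu ⟧ + (2 + ⟦ tw ⟧) → NestedCase tu tr tw X Y Lu Lr Lw Lt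
  nestedCase-impossible len _ disjUW Lu⊆Lr Lw⊆Lr =
    ⊥-elim (ℕ.<⇒≱ (subst₂ _<_ (sym lenR) (sym (cong₂ _+_ lenU lenW)) len)
                  (Disjoint-⊆⇒length+≤ uniqU uniqW disjUW Lu⊆Lr Lw⊆Lr))

⊆-pair⇒∈ : ∀ {L : List ℕ} {a b} → Unique L → 2 ≤ length L → L ⊆ a ∷ b ∷ [] → a ∈ L × b ∈ L
⊆-pair⇒∈ {L} {a} {b} uniq 2≤|L| L⊆ab with a ∈? L | b ∈? L
... | yes a∈L | yes b∈L = a∈L , b∈L
... | no a∉L | _ = ⊥-elim (Unique-⊆⇒≮ uniq L⊆b 2≤|L|)
  where
  L⊆b : L ⊆ b ∷ []
  L⊆b c∈L with L⊆ab c∈L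
  ... | here refl = ⊥-elim (a∉L c∈L)
  ... | there c∈b = c∈b
... | yes _ | no b∉L = ⊥-elim (Unique-⊆⇒≮ uniq L⊆a 2≤|L|)
  where
  L⊆a : L ⊆ a ∷ []
  L⊆a c∈L with L⊆ab c∈L
  ... | here c≡a = here c≡a
  ... | there (here refl) = ⊥-elim (b∉L c∈L)

⟦⟧+⟦⟧<1+⟦⟧+⟦⟧+⟦⟧ : ∀ a b c → ⟦ a ⟧ + ⟦ c ⟧ < suc (⟦ a ⟧ + ⟦ b ⟧ + ⟦ c ⟧)
⟦⟧+⟦⟧<1+⟦⟧+⟦⟧+⟦⟧ a b c = s≤s (ℕ.+-monoˡ-≤ ⟦ c ⟧ (ℕ.m≤m+n ⟦ a ⟧ ⟦ b ⟧))

module _ {tu tr tw : Bool} {X Y Lu Lr Lw Lt : List ℕ} (H : SkeletonLists tu tr tw X Y Lu Lr Lw Lt)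
         (disjXY : Disjoint X Y) {γ : ℕ} (γ∈Lu : γ ∈ Lu) (γ∉Lr : γ ∉ Lr) where
  open SkeletonLists H

  private
    pickT : ∀ cw → ∃[ ct ] ct ∈ Lt × ct ∉ [ γ ]if tu × (T tw → ct ≢ cw)
    pickT cw with pickFrom ([ γ ]if tu ++ [ cw ]if tw) uniqT lenT len
      where
      len : length ([ γ ]if tu ++ [ cw ]if tw) < suc (⟦ tu ⟧ + ⟦ tr ⟧ + ⟦ tw ⟧)
      len rewrite length-++ ([ γ ]if tu) {[ cw ]if tw} | length-[]if γ tu | length-[]if cw tw =
        ⟦⟧+⟦⟧<1+⟦⟧+⟦⟧+⟦⟧ tu tr tw
    ... | ct , ct∈Lt , ct∉ =
      ct , ct∈Lt , (λ m → ct∉ (∈-++⁺ˡ m)) , (λ t → ∉-[]if⇒≢ (λ m → ct∉ (∈-++⁺ʳ ([ γ ]if tu) m)) t)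

    2≤|Lw| : 2 ≤ length Lw
    2≤|Lw| = subst (2 ≤_) (sym lenW) (ℕ.m≤m+n 2 ⟦ tw ⟧)

    ¬T-tw : ∀ {a b} → Lw ⊆ a ∷ b ∷ [] → ¬ T tw
    ¬T-tw Lw⊆ab t = Unique-⊆⇒≮ uniqW Lw⊆ab (subst (2 <_) (sym (trans lenW (cong (2 +_) (T⇒⟦⟧≡1 t)))) ℕ.≤-refl)

    finish : γ ∉ Y → ∀ {cw ct kx} → cw ∈ Lw → ct ∈ Lt → ct ∉ [ γ ]if tu → (T tw → ct ≢ cw) →
             kx ∈ X → kx ∉ γ ∷ cw ∷ ct ∷ [] → SkeletonColouring tu tr tw X Y Lu Lr Lw Lt
    finish γ∉Y {cw} {ct} {kx} cw∈Lw ct∈Lt ct∉ ct≢cw kx∈X kx∉ with coveredByOne⊎both Y cw ct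
    ... | inj₁ (ξ , covY) = completeGivenX H P kx kx∈X kx∉ ξ (Covers-∉ γ∉Y covY) cw (Covers-∉ γ∉Lr Covers-refl)
      where
      P = uwt γ cw ct γ∈Lu cw∈Lw ct∈Lt (∉-[]if⇒≢ ct∉) ct≢cw
    ... | inj₂ (cw∈Y , ct∈Y , _) with pickFrom (cw ∷ ct ∷ []) uniqY lenY ℕ.≤-refl
    ...   | ky , ky∈Y , ky∉ =
      Completion.completeGivenY H P ky ky∈Y (∉₃ (∈-∉⇒≢ ky∈Y γ∉Y) ky≢cw ky≢ct) γ covX
        cw (Covers-∉ γ∉Lr Covers-refl)
      where
      P = uwt γ cw ct γ∈Lu cw∈Lw ct∈Lt (∉-[]if⇒≢ ct∉) ct≢cw
      ky≢cw = proj₁ (∉₂⁻ ky∉)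
      ky≢ct = proj₂ (∉₂⁻ ky∉)
      covX : Covers X (γ ∷ cw ∷ ct ∷ []) (γ ∷ [])
      covX _ (here j≡γ) = here j≡γ
      covX j∈X (there (here refl)) = ⊥-elim (disjXY (j∈X , cw∈Y))
      covX j∈X (there (there (here refl))) = ⊥-elim (disjXY (j∈X , ct∈Y))

    -- Here Lw ⊆ {k₁, k₂} forces tw = false and Lw = {k₁, k₂}; one of k₁, k₂ goes to w, the other to x.
    wInX : γ ∉ Y → ∀ {k₁ k₂} → k₁ ∈ X → k₂ ∈ X → k₁ ≢ γ → k₂ ≢ γ → k₂ ≢ k₁ → Lw ⊆ k₁ ∷ k₂ ∷ [] →
           SkeletonColouring tu tr tw X Y Lu Lr Lw Lt
    wInX γ∉Y {k₁} {k₂} k₁∈X k₂∈X k₁≢γ k₂≢γ k₂≢k₁ Lw⊆k₁k₂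
      with ∃∉⊎⊆ ℕ._≟_ Lt (k₂ ∷ [ γ ]if tu) | ∃∉⊎⊆ ℕ._≟_ Lt (k₁ ∷ [ γ ]if tu)
    ... | inj₁ (ct , ct∈Lt , ct∉) | _ =
      finish γ∉Y (proj₁ (⊆-pair⇒∈ uniqW 2≤|Lw| Lw⊆k₁k₂)) ct∈Lt (λ m → ct∉ (there m))
        (λ t → ⊥-elim (¬T-tw Lw⊆k₁k₂ t))
        k₂∈X (∉₃ k₂≢γ k₂≢k₁ (λ k₂≡ct → ct∉ (here (sym k₂≡ct))))
    ... | inj₂ _ | inj₁ (ct , ct∈Lt , ct∉) =
      finish γ∉Y (proj₂ (⊆-pair⇒∈ uniqW 2≤|Lw| Lw⊆k₁k₂)) ct∈Lt (λ m → ct∉ (there m))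
        (λ t → ⊥-elim (¬T-tw Lw⊆k₁k₂ t))
        k₁∈X (∉₃ k₁≢γ (≢-sym k₂≢k₁) (λ k₁≡ct → ct∉ (here (sym k₁≡ct))))
    ... | inj₂ Lt⊆k₂γ | inj₂ Lt⊆k₁γ = ⊥-elim (Unique-⊆⇒≮ uniqT Lt⊆γ len)
      where
      Lt⊆γ : Lt ⊆ [ γ ]if tu
      Lt⊆γ a∈Lt with Lt⊆k₂γ a∈Lt | Lt⊆k₁γ a∈Lt
      ... | there a∈ | _ = a∈
      ... | here _ | there a∈ = a∈
      ... | here refl | here k₂≡k₁ = ⊥-elim (k₂≢k₁ k₂≡k₁)
      len : length ([ γ ]if tu) < length Lt
      len rewrite lenT | length-[]if γ tu = s≤s (ℕ.≤-trans (ℕ.m≤m+n ⟦ tu ⟧ ⟦ tr ⟧) (ℕ.m≤m+n _ ⟦ tw ⟧))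

  colourU∉Lr-γ∉Y : γ ∉ Y → SkeletonColouring tu tr tw X Y Lu Lr Lw Lt
  colourU∉Lr-γ∉Y γ∉Y with γ ∈? X
  ... | no γ∉X with pickFrom [] uniqW lenW (s≤s z≤n)
  ...   | cw , cw∈Lw , _ with pickT cw
  ...   | ct , ct∈Lt , ct∉ , ct≢cw with pickFrom (cw ∷ ct ∷ []) uniqX lenX ℕ.≤-refl
  ...   | kx , kx∈X , kx∉ =
    finish γ∉Y cw∈Lw ct∈Lt ct∉ ct≢cw kx∈X (∉₃ (∈-∉⇒≢ kx∈X γ∉X) (proj₁ (∉₂⁻ kx∉)) (proj₂ (∉₂⁻ kx∉)))
  colourU∉Lr-γ∉Y γ∉Y | yes γ∈X with pickFrom (γ ∷ []) uniqX lenX (s≤s (s≤s z≤n))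
  ... | k₁ , k₁∈X , k₁∉ with pickFrom (γ ∷ k₁ ∷ []) uniqX lenX ℕ.≤-refl
  ... | k₂ , k₂∈X , k₂∉ with ∃∉⊎⊆ ℕ._≟_ Lw (k₁ ∷ k₂ ∷ [])
  ...   | inj₂ Lw⊆k₁k₂ =
    wInX γ∉Y k₁∈X k₂∈X (λ k₁≡γ → k₁∉ (here k₁≡γ)) (proj₁ (∉₂⁻ k₂∉)) (proj₂ (∉₂⁻ k₂∉)) Lw⊆k₁k₂
  ...   | inj₁ (cw , cw∈Lw , cw∉) with pickT cw
  ...   | ct , ct∈Lt , ct∉ , ct≢cw with ct ℕ.≟ k₁
  ...     | yes refl = finish γ∉Y cw∈Lw ct∈Lt ct∉ ct≢cw k₂∈X
                         (∉₃ (proj₁ (∉₂⁻ k₂∉)) (λ k₂≡cw → cw∉ (there (here (sym k₂≡cw)))) (proj₂ (∉₂⁻ k₂∉)))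
  ...     | no ct≢k₁ = finish γ∉Y cw∈Lw ct∈Lt ct∉ ct≢cw k₁∈X
                         (∉₃ (λ k₁≡γ → k₁∉ (here k₁≡γ)) (λ k₁≡cw → cw∉ (here (sym k₁≡cw))) (≢-sym ct≢k₁))

-- u takes a colour γ that r cannot use, so r has one fewer colour to avoid.
colourU∉Lr : ∀ {tu tr tw X Y Lu Lr Lw Lt} → SkeletonLists tu tr tw X Y Lu Lr Lw Lt → Disjoint X Y →
             ∀ {γ} → γ ∈ Lu → γ ∉ Lr → SkeletonColouring tu tr tw X Y Lu Lr Lw Lt
colourU∉Lr {Y = Y} H disjXY {γ} γ∈Lu γ∉Lr with γ ∈? Y
... | no γ∉Y = colourU∉Lr-γ∉Y H disjXY γ∈Lu γ∉Lr γ∉Y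
... | yes γ∈Y = SkeletonColouring-swapXY
  (colourU∉Lr-γ∉Y (SkeletonLists-swapXY H) (λ (a∈Y , a∈X) → disjXY (a∈X , a∈Y)) γ∈Lu γ∉Lr
    (λ γ∈X → disjXY (γ∈X , γ∈Y)))

1≤⟦⟧+⟦⟧+⟦⟧ : ∀ a b c → T (a ∨ b ∨ c) → 1 ≤ ⟦ a ⟧ + ⟦ b ⟧ + ⟦ c ⟧
1≤⟦⟧+⟦⟧+⟦⟧ true _ _ _ = s≤s z≤n
1≤⟦⟧+⟦⟧+⟦⟧ false true _ _ = s≤s z≤n
1≤⟦⟧+⟦⟧+⟦⟧ false false true _ = s≤s z≤n

1<|Lt| : ∀ {tu tr tw X Y Lu Lr Lw Lt} → SkeletonLists tu tr tw X Y Lu Lr Lw Lt → T (tu ∨ tr ∨ tw) → 1 < length Lt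
1<|Lt| {tu} {tr} {tw} H t = subst (1 <_) (sym (SkeletonLists.lenT H)) (s≤s (1≤⟦⟧+⟦⟧+⟦⟧ tu tr tw t))

colourSkeletonWith : ∀ {tu tr tw X Y Lu Lr Lw Lt} → SkeletonLists tu tr tw X Y Lu Lr Lw Lt → T (tu ∨ tr ∨ tw) →
                     TightCase tu tr tw X Y Lu Lr Lw Lt → NestedCase tu tr tw X Y Lu Lr Lw Lt →
                     SkeletonColouring tu tr tw X Y Lu Lr Lw Lt
colourSkeletonWith {X = X} {Y} {Lu} {Lr} {Lw} H t tight nested with ∃∈⊎Disjoint ℕ._≟_ Lu Lw
... | inj₁ (α , α∈Lu , α∈Lw) = sameColourUW H α∈Lu α∈Lw tight
... | inj₂ disjUW with ∃∈⊎Disjoint ℕ._≟_ X Y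
...   | inj₁ (β , β∈X , β∈Y) with β ∈? Lu
...     | no β∉Lu = sameColourXY H (1<|Lt| H t) β∈X β∈Y β∉Lu
...     | yes β∈Lu = SkeletonColouring-swapUW
  (sameColourXY (SkeletonLists-swapUW H) (1<|Lt| H t) β∈X β∈Y (λ β∈Lw → disjUW (β∈Lu , β∈Lw)))
colourSkeletonWith {Lu = Lu} {Lr} {Lw} H t tight nested | inj₂ disjUW | inj₂ disjXY with ∃∉⊎⊆ ℕ._≟_ Lu Lr
... | inj₁ (γ , γ∈Lu , γ∉Lr) = colourU∉Lr H disjXY γ∈Lu γ∉Lr
... | inj₂ Lu⊆Lr with ∃∉⊎⊆ ℕ._≟_ Lw Lr
...   | inj₁ (γ , γ∈Lw , γ∉Lr) = SkeletonColouring-swapUW (colourU∉Lr (SkeletonLists-swapUW H) disjXY γ∈Lw γ∉Lr)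
...   | inj₂ Lw⊆Lr = nested disjXY disjUW Lu⊆Lr Lw⊆Lr

-- When t is a third leaf of r, the vertices u, w, t play symmetric roles.
module _ {X Y Lu Lr Lw Lt : List ℕ} (H : SkeletonLists false true false X Y Lu Lr Lw Lt) where
  open SkeletonLists H

  nested-K13 : NestedCase false true false X Y Lu Lr Lw Lt
  nested-K13 disjXY disjUW Lu⊆Lr Lw⊆Lr with ∃∉⊎⊆ ℕ._≟_ Lt Lr
  ... | inj₁ (γ , γ∈Lt , γ∉Lr) = SkeletonColouring-swapUT (colourU∉Lr (SkeletonLists-swapUT H) disjXY γ∈Lt γ∉Lr)
  ... | inj₂ Lt⊆Lr with ∃∈⊎Disjoint ℕ._≟_ Lu Lt
  ...   | inj₁ (α , α∈Lu , α∈Lt) = SkeletonColouring-swapWT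
    (sameColourUW (SkeletonLists-swapWT H) α∈Lu α∈Lt (tightCase-impossible (SkeletonLists-swapWT H) ℕ.≤-refl))
  ...   | inj₂ disjUT with ∃∈⊎Disjoint ℕ._≟_ Lw Lt
  ...     | inj₁ (α , α∈Lw , α∈Lt) = SkeletonColouring-swapUT
    (sameColourUW (SkeletonLists-swapUT H) α∈Lt α∈Lw (tightCase-impossible (SkeletonLists-swapUT H) ℕ.≤-refl))
  ...     | inj₂ disjWT = ⊥-elim (ℕ.<⇒≱ (ℕ.≤ᵇ⇒≤ 5 6 _) (subst₂ _≤_ sizes lenR bound))
    where
    disjUW-T : Disjoint (Lu ++ Lw) Lt
    disjUW-T (a∈Lu++Lw , a∈Lt) with ∈-++⁻ Lu a∈Lu++Lw
    ... | inj₁ a∈Lu = disjUT (a∈Lu , a∈Lt)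
    ... | inj₂ a∈Lw = disjWT (a∈Lw , a∈Lt)
    Lu++Lw⊆Lr : Lu ++ Lw ⊆ Lr
    Lu++Lw⊆Lr a∈ with ∈-++⁻ Lu a∈
    ... | inj₁ a∈Lu = Lu⊆Lr a∈Lu
    ... | inj₂ a∈Lw = Lw⊆Lr a∈Lw
    bound : length (Lu ++ Lw) + length Lt ≤ length Lr
    bound = Disjoint-⊆⇒length+≤ (++⁺ uniqU uniqW disjUW) uniqT disjUW-T Lu++Lw⊆Lr Lt⊆Lr
    sizes : length (Lu ++ Lw) + length Lt ≡ 6
    sizes rewrite length-++ Lu {Lw} | lenU | lenW | lenT = refl

colourSkeleton : ∀ {tu tr tw X Y Lu Lr Lw Lt} → T (tu ∨ tr ∨ tw) → SkeletonLists tu tr tw X Y Lu Lr Lw Lt →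
                 SkeletonColouring tu tr tw X Y Lu Lr Lw Lt
colourSkeleton {true} {false} {false} t H =
  colourSkeletonWith H t (tightCase-P4 H refl refl refl) (nestedCase-impossible H (ℕ.≤ᵇ⇒≤ 4 5 _))
colourSkeleton {false} {false} {true} t H = SkeletonColouring-swapUW (colourSkeleton t (SkeletonLists-swapUW H))
colourSkeleton {false} {true} {false} t H = colourSkeletonWith H t (tightCase-impossible H ℕ.≤-refl) (nested-K13 H)
colourSkeleton {true} {false} {true} t H =
  colourSkeletonWith H t (tightCase-impossible H (ℕ.≤ᵇ⇒≤ 3 3 _)) (nestedCase-impossible H (ℕ.≤ᵇ⇒≤ 4 6 _))
colourSkeleton {true} {true} {false} t H =
  colourSkeletonWith H t (tightCase-impossible H (ℕ.≤ᵇ⇒≤ 3 3 _)) (nestedCase-impossible H (ℕ.≤ᵇ⇒≤ 5 5 _))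
colourSkeleton {false} {true} {true} t H =
  colourSkeletonWith H t (tightCase-impossible H (ℕ.≤ᵇ⇒≤ 3 3 _)) (nestedCase-impossible H (ℕ.≤ᵇ⇒≤ 5 5 _))
colourSkeleton {true} {true} {true} t H =
  colourSkeletonWith H t (tightCase-impossible H (ℕ.≤ᵇ⇒≤ 3 4 _)) (nestedCase-impossible H (ℕ.≤ᵇ⇒≤ 5 6 _))

module _ {A : Set} (_≟_ : DecidableEquality A) where

  lookupOr0 : List (A × ℕ) → A → ℕ
  lookupOr0 [] _ = 0
  lookupOr0 ((a , k) ∷ ps) z with z ≟ a
  ... | yes _ = k
  ... | no _ = lookupOr0 ps z

  lookupOr0-∈ : ∀ ps {a k} → Unique (map proj₁ ps) → (a , k) ∈ ps → lookupOr0 ps a ≡ k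
  lookupOr0-∈ ((b , _) ∷ ps) {a} _ (here refl) with a ≟ a
  ... | yes _ = refl
  ... | no a≢a = ⊥-elim (a≢a refl)
  lookupOr0-∈ ((b , _) ∷ ps) {a} (b∉ps ∷ uniq) (there ak∈ps) with a ≟ b
  ... | yes refl = ⊥-elim (All.lookup b∉ps (key∈ ak∈ps) refl)
    where
    key∈ : ∀ {qs : List (A × ℕ)} {a k} → (a , k) ∈ qs → a ∈ map proj₁ qs
    key∈ (here refl) = here refl
    key∈ (there m) = there (key∈ m)
  ... | no _ = lookupOr0-∈ ps uniq ak∈ps

take-length : ∀ {A : Set} k {L : List A} → k ≤ length L → length (take k L) ≡ k
take-length k {L} k≤|L| = trans (length-take k L) (ℕ.m≤n⇒m⊓n≡m k≤|L|)

∈-take : ∀ {A : Set} {a : A} k {L} → a ∈ take k L → a ∈ L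
∈-take (suc k) {_ ∷ L} (here a≡b) = here a≡b
∈-take (suc k) {_ ∷ L} (there a∈) = there (∈-take k a∈)

x y : ∀ {n} → Fin (n + 2)
x {n} = n ↑ʳ 0F
y {n} = n ↑ʳ sucF 0F

x≢y : ∀ {n} → x {n} ≢ y
x≢y {n} e with ↑ʳ-injective n 0F (sucF 0F) e
... | ()

module _ {n : ℕ} (A : Graph n) where
  private
    G = joinE2 A

  adj-joinE2-↑ˡ↑ˡ : ∀ a b → adj G (a ↑ˡ 2) (b ↑ˡ 2) ≡ adj A a b
  adj-joinE2-↑ˡ↑ˡ a b rewrite splitAt-↑ˡ n a 2 | splitAt-↑ˡ n b 2 = refl

  adj-joinE2-↑ʳ↑ʳ : ∀ i j → adj G (n ↑ʳ i) (n ↑ʳ j) ≡ false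
  adj-joinE2-↑ʳ↑ʳ i j rewrite splitAt-↑ʳ n 2 i | splitAt-↑ʳ n 2 j = refl

  adj-joinE2-E₂ : ∀ v i → v ≢ x → v ≢ y → Adj G v (n ↑ʳ i)
  adj-joinE2-E₂ v i v≢x v≢y with splitAt n v in eq
  ... | inj₁ _ rewrite splitAt-↑ʳ n 2 i = refl
  ... | inj₂ 0F = ⊥-elim (v≢x (sym (splitAt⁻¹-↑ʳ eq)))
  ... | inj₂ (sucF 0F) = ⊥-elim (v≢y (sym (splitAt⁻¹-↑ʳ eq)))

module _ {n : ℕ} {A : Graph n} (S : Skeleton A) where
  open Skeleton S
  private
    G = joinE2 A

  u′ r′ w′ t′ : Fin (n + 2)
  u′ = u ↑ˡ 2
  r′ = r ↑ˡ 2
  w′ = w ↑ˡ 2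
  t′ = t ↑ˡ 2

  skeletonVertices : List (Fin (n + 2))
  skeletonVertices = x ∷ y ∷ u′ ∷ r′ ∷ w′ ∷ t′ ∷ []

  private
    K = skeletonVertices

    ↑ˡ≢↑ʳ : ∀ a i → a ↑ˡ 2 ≢ n ↑ʳ i
    ↑ˡ≢↑ʳ a i e with trans (sym (splitAt-↑ˡ n a 2)) (trans (cong (splitAt n) e) (splitAt-↑ʳ n 2 i))
    ... | ()

    ↑ˡ-≢ : ∀ {a b : Fin n} → a ≢ b → a ↑ˡ 2 ≢ b ↑ˡ 2
    ↑ˡ-≢ a≢b e = a≢b (↑ˡ-injective 2 _ _ e)

    x≢↑ˡ : ∀ a → x ≢ a ↑ˡ 2
    x≢↑ˡ a = ≢-sym (↑ˡ≢↑ʳ a 0F)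

    y≢↑ˡ : ∀ a → y ≢ a ↑ˡ 2
    y≢↑ˡ a = ≢-sym (↑ˡ≢↑ʳ a (sucF 0F))

    u≢r : u ≢ r
    u≢r refl = ¬Adj-refl A u u~r
    r≢w : r ≢ w
    r≢w refl = ¬Adj-refl A r r~w
    t≢u = proj₁ (∉₃⁻ t∉urw)
    t≢r = proj₁ (proj₂ (∉₃⁻ t∉urw))
    t≢w = proj₂ (proj₂ (∉₃⁻ t∉urw))

  Unique-skeletonVertices : Unique skeletonVertices
  Unique-skeletonVertices =
      (x≢y ∷ x≢↑ˡ u ∷ x≢↑ˡ r ∷ x≢↑ˡ w ∷ x≢↑ˡ t ∷ [])
    ∷ (y≢↑ˡ u ∷ y≢↑ˡ r ∷ y≢↑ˡ w ∷ y≢↑ˡ t ∷ [])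
    ∷ (↑ˡ-≢ u≢r ∷ ↑ˡ-≢ (≢-sym w≢u) ∷ ↑ˡ-≢ (≢-sym t≢u) ∷ [])
    ∷ (↑ˡ-≢ r≢w ∷ ↑ˡ-≢ (≢-sym t≢r) ∷ [])
    ∷ (↑ˡ-≢ (≢-sym t≢w) ∷ [])
    ∷ [] ∷ []

  private
    tu tr tw : Bool
    tu = adj A t u
    tr = adj A t r
    tw = adj A t w

    degree-x : degreeIn G K x ≡ 4
    degree-x rewrite degreeIn≡sum G K x | splitAt-↑ʳ n 2 0F | splitAt-↑ʳ n 2 (sucF 0F)
                   | splitAt-↑ˡ n u 2 | splitAt-↑ˡ n r 2 | splitAt-↑ˡ n w 2 | splitAt-↑ˡ n t 2 = refl

    degree-y : degreeIn G K y ≡ 4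
    degree-y rewrite degreeIn≡sum G K y | splitAt-↑ʳ n 2 0F | splitAt-↑ʳ n 2 (sucF 0F)
                   | splitAt-↑ˡ n u 2 | splitAt-↑ˡ n r 2 | splitAt-↑ˡ n w 2 | splitAt-↑ˡ n t 2 = refl

    degree-u : degreeIn G K u′ ≡ 3 + ⟦ tu ⟧
    degree-u rewrite degreeIn≡sum G K u′ | splitAt-↑ʳ n 2 0F | splitAt-↑ʳ n 2 (sucF 0F)
                   | splitAt-↑ˡ n u 2 | splitAt-↑ˡ n r 2 | splitAt-↑ˡ n w 2 | splitAt-↑ˡ n t 2
                   | irref A u | u~r | u≁w | Graph.sym A u t | ℕ.+-identityʳ ⟦ tu ⟧ = refl

    degree-r : degreeIn G K r′ ≡ 4 + ⟦ tr ⟧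
    degree-r rewrite degreeIn≡sum G K r′ | splitAt-↑ʳ n 2 0F | splitAt-↑ʳ n 2 (sucF 0F)
                   | splitAt-↑ˡ n u 2 | splitAt-↑ˡ n r 2 | splitAt-↑ˡ n w 2 | splitAt-↑ˡ n t 2
                   | irref A r | r~w | Graph.sym A r u | u~r | Graph.sym A r t | ℕ.+-identityʳ ⟦ tr ⟧ = refl

    degree-w : degreeIn G K w′ ≡ 3 + ⟦ tw ⟧
    degree-w rewrite degreeIn≡sum G K w′ | splitAt-↑ʳ n 2 0F | splitAt-↑ʳ n 2 (sucF 0F)
                   | splitAt-↑ˡ n u 2 | splitAt-↑ˡ n r 2 | splitAt-↑ˡ n w 2 | splitAt-↑ˡ n t 2
                   | irref A w | Graph.sym A w u | u≁w | Graph.sym A w r | r~w | Graph.sym A w t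
                   | ℕ.+-identityʳ ⟦ tw ⟧ = refl

    degree-t : degreeIn G K t′ ≡ 2 + (⟦ tu ⟧ + ⟦ tr ⟧ + ⟦ tw ⟧)
    degree-t rewrite degreeIn≡sum G K t′ | splitAt-↑ʳ n 2 0F | splitAt-↑ʳ n 2 (sucF 0F)
                   | splitAt-↑ˡ n u 2 | splitAt-↑ˡ n r 2 | splitAt-↑ˡ n w 2 | splitAt-↑ˡ n t 2
                   | irref A t | ℕ.+-identityʳ ⟦ tw ⟧ = cong (2 +_) (sym (ℕ.+-assoc ⟦ tu ⟧ ⟦ tr ⟧ ⟦ tw ⟧))

  data SkeletonVertex : Set where
    vx vy vu vr vw vt : SkeletonVertex

  vertex : SkeletonVertex → Fin (n + 2)
  vertex vx = x
  vertex vy = y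
  vertex vu = u′
  vertex vr = r′
  vertex vw = w′
  vertex vt = t′

  private
    toSkeletonVertex : ∀ {z} → z ∈ K → ∃[ v ] z ≡ vertex v
    toSkeletonVertex (here e) = vx , e
    toSkeletonVertex (there (here e)) = vy , e
    toSkeletonVertex (there (there (here e))) = vu , e
    toSkeletonVertex (there (there (there (here e)))) = vr , e
    toSkeletonVertex (there (there (there (there (here e))))) = vw , e
    toSkeletonVertex (there (there (there (there (there (here e)))))) = vt , e

    Adj-A : ∀ {a b} → Adj G (a ↑ˡ 2) (b ↑ˡ 2) → Adj A a b
    Adj-A {a} {b} e = trans (sym (adj-joinE2-↑ˡ↑ˡ A a b)) e

    T-adj : ∀ {a b} → Adj G (a ↑ˡ 2) (b ↑ˡ 2) → T (adj A a b)
    T-adj e = from T-≡ (Adj-A e)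

    T-adj-sym : ∀ {a b} → Adj G (a ↑ˡ 2) (b ↑ˡ 2) → T (adj A b a)
    T-adj-sym {a} {b} e = from T-≡ (trans (Graph.sym A b a) (Adj-A e))

    ¬Adj-xy : ∀ {i j} → ¬ Adj G (n ↑ʳ i) (n ↑ʳ j)
    ¬Adj-xy {i} {j} e with trans (sym e) (adj-joinE2-↑ʳ↑ʳ A i j)
    ... | ()

    ¬Adj-uw : ¬ Adj G u′ w′
    ¬Adj-uw e with trans (sym (Adj-A e)) u≁w
    ... | ()

    ¬Adj-wu : ¬ Adj G w′ u′
    ¬Adj-wu e with trans (sym (trans (Graph.sym A u w) (Adj-A e))) u≁w
    ... | ()

    module Colouring {X Y Lu Lr Lw Lt} (col : SkeletonColouring tu tr tw X Y Lu Lr Lw Lt) where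
      open SkeletonColouring col

      colour : SkeletonVertex → ℕ
      colour vx = cx
      colour vy = cy
      colour vu = cu
      colour vr = cr
      colour vw = cw
      colour vt = ct

      proper : ∀ v v′ → Adj G (vertex v) (vertex v′) → colour v ≢ colour v′
      proper vx vx e = ⊥-elim (¬Adj-refl G x e)
      proper vx vy e = ⊥-elim (¬Adj-xy e)
      proper vx vu _ = proj₁ (∉₃⁻ cx∉uwt)
      proper vx vr _ = cx≢cr
      proper vx vw _ = proj₁ (proj₂ (∉₃⁻ cx∉uwt))
      proper vx vt _ = proj₂ (proj₂ (∉₃⁻ cx∉uwt))
      proper vy vx e = ⊥-elim (¬Adj-xy e)
      proper vy vy e = ⊥-elim (¬Adj-refl G y e)
      proper vy vu _ = proj₁ (∉₃⁻ cy∉uwt)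
      proper vy vr _ = cy≢cr
      proper vy vw _ = proj₁ (proj₂ (∉₃⁻ cy∉uwt))
      proper vy vt _ = proj₂ (proj₂ (∉₃⁻ cy∉uwt))
      proper vu vx _ = ≢-sym (proj₁ (∉₃⁻ cx∉uwt))
      proper vu vy _ = ≢-sym (proj₁ (∉₃⁻ cy∉uwt))
      proper vu vu e = ⊥-elim (¬Adj-refl G u′ e)
      proper vu vr _ = ≢-sym cr≢cu
      proper vu vw e = ⊥-elim (¬Adj-uw e)
      proper vu vt e = ≢-sym (ct≢cu (T-adj-sym e))
      proper vr vx _ = ≢-sym cx≢cr
      proper vr vy _ = ≢-sym cy≢cr
      proper vr vu _ = cr≢cu
      proper vr vr e = ⊥-elim (¬Adj-refl G r′ e)
      proper vr vw _ = cr≢cw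
      proper vr vt e = cr≢ct (T-adj-sym e)
      proper vw vx _ = ≢-sym (proj₁ (proj₂ (∉₃⁻ cx∉uwt)))
      proper vw vy _ = ≢-sym (proj₁ (proj₂ (∉₃⁻ cy∉uwt)))
      proper vw vu e = ⊥-elim (¬Adj-wu e)
      proper vw vr _ = ≢-sym cr≢cw
      proper vw vw e = ⊥-elim (¬Adj-refl G w′ e)
      proper vw vt e = ≢-sym (ct≢cw (T-adj-sym e))
      proper vt vx _ = ≢-sym (proj₂ (proj₂ (∉₃⁻ cx∉uwt)))
      proper vt vy _ = ≢-sym (proj₂ (proj₂ (∉₃⁻ cy∉uwt)))
      proper vt vu e = ct≢cu (T-adj e)
      proper vt vr e = ≢-sym (cr≢ct (T-adj e))
      proper vt vw e = ct≢cw (T-adj e)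
      proper vt vt e = ⊥-elim (¬Adj-refl G t′ e)

  D1ChoosableOn-skeleton : D1ChoosableOn G skeletonVertices
  D1ChoosableOn-skeleton L sizes = c , c∈L , c-proper
    where
    open Colouring

    truncate : ∀ {v} k → v ∈ K → degreeIn G K v ≡ suc k → Unique (take k (L v)) × length (take k (L v)) ≡ k
    truncate {v} k v∈K deg =
      take⁺ k (proj₁ (sizes v v∈K)) , take-length k (subst (λ d → d ∸ 1 ≤ length (L v)) deg (proj₂ (sizes v v∈K)))

    H : SkeletonLists tu tr tw (take 3 (L x)) (take 3 (L y)) (take (2 + ⟦ tu ⟧) (L u′)) (take (3 + ⟦ tr ⟧) (L r′))
                               (take (2 + ⟦ tw ⟧) (L w′)) (take (suc (⟦ tu ⟧ + ⟦ tr ⟧ + ⟦ tw ⟧)) (L t′))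
    H = record
      { uniqX = proj₁ hx ; uniqY = proj₁ hy ; uniqU = proj₁ hu ; uniqR = proj₁ hr ; uniqW = proj₁ hw ; uniqT = proj₁ ht
      ; lenX = proj₂ hx ; lenY = proj₂ hy ; lenU = proj₂ hu ; lenR = proj₂ hr ; lenW = proj₂ hw ; lenT = proj₂ ht }
      where
      hx = truncate 3 (here refl) degree-x
      hy = truncate 3 (there (here refl)) degree-y
      hu = truncate _ (there (there (here refl))) degree-u
      hr = truncate _ (there (there (there (here refl)))) degree-r
      hw = truncate _ (there (there (there (there (here refl))))) degree-w
      ht = truncate _ (there (there (there (there (there (here refl)))))) degree-t

    col = colourSkeleton t~urw H
    open SkeletonColouring col

    c : Fin (n + 2) → ℕ
    c = lookupOr0 _≟_ ((x , cx) ∷ (y , cy) ∷ (u′ , cu) ∷ (r′ , cr) ∷ (w′ , cw) ∷ (t′ , ct) ∷ [])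

    c-vertex : ∀ v → c (vertex v) ≡ colour col v
    c-vertex vx = lookupOr0-∈ _≟_ _ Unique-skeletonVertices (here refl)
    c-vertex vy = lookupOr0-∈ _≟_ _ Unique-skeletonVertices (there (here refl))
    c-vertex vu = lookupOr0-∈ _≟_ _ Unique-skeletonVertices (there (there (here refl)))
    c-vertex vr = lookupOr0-∈ _≟_ _ Unique-skeletonVertices (there (there (there (here refl))))
    c-vertex vw = lookupOr0-∈ _≟_ _ Unique-skeletonVertices (there (there (there (there (here refl)))))
    c-vertex vt = lookupOr0-∈ _≟_ _ Unique-skeletonVertices (there (there (there (there (there (here refl))))))

    colour∈L : ∀ v → colour col v ∈ L (vertex v)
    colour∈L vx = ∈-take 3 cx∈X
    colour∈L vy = ∈-take 3 cy∈Y
    colour∈L vu = ∈-take _ cu∈Lu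
    colour∈L vr = ∈-take _ cr∈Lr
    colour∈L vw = ∈-take _ cw∈Lw
    colour∈L vt = ∈-take _ ct∈Lt

    c∈L : ∀ z → z ∈ K → c z ∈ L z
    c∈L z z∈K with toSkeletonVertex z∈K
    ... | v , refl = subst (_∈ L (vertex v)) (sym (c-vertex v)) (colour∈L v)

    c-proper : ∀ a b → a ∈ K → b ∈ K → Adj G a b → c a ≢ c b
    c-proper a b a∈K b∈K ab with toSkeletonVertex a∈K | toSkeletonVertex b∈K
    ... | v , refl | v′ , refl rewrite c-vertex v | c-vertex v′ = proper col v v′ ab

skeleton⇒D1Choosable : ∀ {n} {A : Graph n} → Skeleton A → D1Choosable (joinE2 A)
skeleton⇒D1Choosable {n} {A} S
  with complement _≟_ (allFin (n + 2)) (skeletonVertices S) (allFin⁺ (n + 2)) (Unique-skeletonVertices S)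
... | R , uniq , covers , R∌K =
  D1ChoosableOn⇒D1Choosable G uniq (λ v → covers (∈-allFin v))
    (D1ChoosableOn-++ G x≢y (here refl) (there (here refl)) R uniq adjacentToE₂ (D1ChoosableOn-skeleton S))
  where
  G = joinE2 A
  adjacentToE₂ : ∀ {v} → v ∈ R → Adj G v x × Adj G v y
  adjacentToE₂ {v} v∈R = adj-joinE2-E₂ A v 0F v≢x v≢y , adj-joinE2-E₂ A v (sucF 0F) v≢x v≢y
    where
    v≢x = λ { refl → R∌K v∈R (here refl) }
    v≢y = λ { refl → R∌K v∈R (there (here refl)) }

mainTheorem19 : (n : ℕ) → n ≥ 4 → (A : Graph n) → Connected A → ¬ Complete A →
                D1Choosable (joinE2 A)
mainTheorem19 n 4≤n A connected ¬complete = skeleton⇒D1Choosable (skeleton A 4≤n connected ¬complete)
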